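{- Cut-elimination holds in $\mathsf{LKQ}$: every typing judgement derivable in $\mathsf{LKQ}$ (for a command, expression, value or context) is derivable for a term obtained from the original one by the reduction rules of $\mathsf{L}_{\mathrm{foc}}$ which is in normal form; such a normal term contains no explicit substitutions and all its commands are of one of the shapes $\langle\widehat V|\alpha\rangle$, $\langle\widehat x|\tilde\mu\alpha^\bullet.c\rangle$, $\langle\widehat x|\tilde\mu(x_1,x_2).c\rangle$, $\langle\widehat x|\tilde\mu[\mathrm{inl}(x_1).c_1|\mathrm{inr}(x_2).c_2]\rangle$ (i.e. it denotes a cut-free proof).
   Context: $\mathsf{LKQ}$ / $\mathsf{L}_{\mathrm{foc}}$. Positive formulas: $P::=X\mid P\otimes P\mid P\oplus P\mid\neg P$. Terms: commands $c::=\langle v|e\rangle\mid c[\sigma]$; expressions $v::=\widehat V\mid\mu\alpha.c\mid v[\sigma]$; values $V::=x\mid(V,V)\mid\mathrm{inl}(V)\mid\mathrm{inr}(V)\mid e^\bullet\mid V[\sigma]$; contexts $e::=\alpha\mid\tilde\mu x.c\mid\tilde\mu\alpha^\bullet.c\mid\tilde\mu(x_1,x_2).c\mid\tilde\mu[\mathrm{inl}(x_1).c_1|\mathrm{inr}(x_2).c_2]\mid e[\sigma]$, $\sigma$ a list of explicit substitutions $[x_i\leftarrow V_i],[\alpha_j\leftarrow e_j]$. Judgements $c:(\Gamma\vdash\Delta)$, $\Gamma\vdash v:P\mid\Delta$, $\Gamma\vdash V:P;\Delta$, $\Gamma\mid e:P\vdash\Delta$, with rules: $\Gamma,x:P\vdash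 x:P;\Delta$; $\Gamma\mid\alpha:P\vdash\alpha:P,\Delta$; cut: from $\Gamma\vdash v:P\mid\Delta$, $\Gamma\mid e:P\vdash\Delta$ infer $\langle v|e\rangle:(\Gamma\vdash\Delta)$; $\tilde\mu x.c:P$ from $c:(\Gamma,x:P\vdash\Delta)$; $\mu\alpha.c:P$ from $c:(\Gamma\vdash\alpha:P,\Delta)$; $\widehat V:P$ from $V:P$; $e^\bullet:\neg P$ from $e:P$; $(V_1,V_2):P_1\otimes P_2$, $\mathrm{inl}(V_1),\mathrm{inr}(V_2):P_1\oplus P_2$ from values of the components; $\tilde\mu\alpha^\bullet.c:\neg P$ from $c:(\Gamma\vdash\alpha:P,\Delta)$; $\tilde\mu(x_1,x_2).c:P_1\otimes P_2$ from $c:(\Gamma,x_1:P_1,x_2:P_2\vdash\Delta)$; $\tilde\mu[\mathrm{inl}(x_1).c_1|\mathrm{inr}(x_2).c_2]:P_1\oplus P_2$ from $c_i:(\Gamma,x_i:P_i\vdash\Delta)$; $t[x_i\leftarrow V_i,\alpha_j\leftarrow e_j]$ typed in $\Gamma,\Delta$ when $t$ is typed in $\Gamma,\ldots,x_i:P_i,\ldots\,/\,\Delta,\ldots,\alpha_j:Q_j,\ldots$ with $\Gamma\vdash V_i:P_i;\Delta$ and $\Gamma\mid e_j:Q_j\vdash\Delta$. Weakening is implicit. Reduction rules of $\mathsf{L}_{\mathrm{foc}}$: (control) $\langle\mu\alpha.c|e\rangle\to c[\alpha\leftarrow e]$, $\langle\widehat V|\tilde\mu x.c\rangle\to c[x\leftarrow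 V]$; (logical) $\langle\widehat{e^\bullet}|\tilde\mu\alpha^\bullet.c\rangle\to c[\alpha\leftarrow e]$, $\langle\widehat{(V_1,V_2)}|\tilde\mu(x_1,x_2).c\rangle\to c[x_1\leftarrow V_1,x_2\leftarrow V_2]$, $\langle\widehat{\mathrm{inl}(V_1)}|\tilde\mu[\mathrm{inl}(x_1).c_1|\mathrm{inr}(x_2).c_2]\rangle\to c_1[x_1\leftarrow V_1]$ and symmetrically for $\mathrm{inr}$; (commutation) the rules propagating explicit substitutions capture-avoidingly through the term structure down to variables: $\langle v|e\rangle[\sigma]\to\langle v[\sigma]|e[\sigma]\rangle$, $x[\sigma]\to x$ if $x$ not declared in $\sigma$, $x[x\leftarrow V,\sigma]\to V$ (likewise for $\alpha$), $(\mu\alpha.c)[\sigma]\to\mu\alpha.(c[\sigma])$, etc., with no rule composing substitutions. -}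

module Defs where

open import Data.Nat using (ℕ; zero; suc; _+_; _∸_; _≤_; _<ᵇ_)
open import Data.Bool using (if_then_else_)
open import Data.List using (List; []; _∷_; _++_; length)
open import Data.Maybe using (Maybe; just; nothing)
open import Relation.Binary.PropositionalEquality using (_≡_)
open import Relation.Nullary using (¬_)

data Formula : Set where
  atom : ℕ → Formula
  _⊗_  : Formula → Formula → Formula
  _⊕_  : Formula → Formula → Formula
  neg  : Formula → Formula

-- Raw syntax, de Bruijn indices: value variables x and co-variables α
-- live in two separate index spaces.  An explicit substitution
-- σ = (Vs ,, es) binds, in the term it is attached to, the first
-- (length Vs) value variables (index i ↦ i-th element of Vs) and the
-- first (length es) co-variables.

infix 4 _,,_

mutual
  data Cmd : Set where
    ⟨_∣_⟩ : Expr → Ctx → Cmd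
    csub  : Cmd → Subst → Cmd

  data Expr : Set where
    val  : Val → Expr                         -- \hat V
    mu   : Cmd → Expr                         -- μα.c   (α = covar 0)
    esub : Expr → Subst → Expr

  data Val : Set where
    var   : ℕ → Val
    pair  : Val → Val → Val
    inl   : Val → Val
    inr   : Val → Val
    thunk : Ctx → Val                         -- e•
    vsub  : Val → Subst → Val

  data Ctx : Set where
    covar  : ℕ → Ctx
    mut    : Cmd → Ctx                        -- μ̃x.c         (x = var 0)
    mutneg : Cmd → Ctx                        -- μ̃α•.c        (α = covar 0)
    mupair : Cmd → Ctx                        -- μ̃(x₁,x₂).c   (x₁ = var 0, x₂ = var 1)
    mucase : Cmd → Cmd → Ctx                  -- μ̃[inl(x₁).c₁ | inr(x₂).c₂]  (xᵢ = var 0 in cᵢ)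
    ksub   : Ctx → Subst → Ctx

  data Subst : Set where
    _,,_ : List Val → List Ctx → Subst

nth : {A : Set} → List A → ℕ → Maybe A
nth []       _       = nothing
nth (x ∷ xs) zero    = just x
nth (x ∷ xs) (suc i) = nth xs i

lenV : Subst → ℕ
lenV (Vs ,, es) = length Vs

lenK : Subst → ℕ
lenK (Vs ,, es) = length es

lift : (ℕ → ℕ) → ℕ → ℕ
lift ρ zero    = zero
lift ρ (suc i) = suc (ρ i)

liftN : ℕ → (ℕ → ℕ) → ℕ → ℕ
liftN zero    ρ = ρ
liftN (suc n) ρ = lift (liftN n ρ)

-- rot n k : moves the n innermost indices behind the next k ones
-- (i < n ↦ i + k ; n ≤ i < n + k ↦ i ∸ n ; otherwise unchanged).
-- Used to push an explicit substitution binding k variables under a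
-- binder of n variables (de Bruijn rendering of capture avoidance).
rot : ℕ → ℕ → ℕ → ℕ
rot n k i = if i <ᵇ n then i + k else (if i <ᵇ n + k then i ∸ n else i)

mutual
  renC : (ℕ → ℕ) → (ℕ → ℕ) → Cmd → Cmd
  renC ρ κ ⟨ v ∣ e ⟩ = ⟨ renE ρ κ v ∣ renK ρ κ e ⟩
  renC ρ κ (csub c (Vs ,, es)) =
    csub (renC (liftN (length Vs) ρ) (liftN (length es) κ) c) (renVs ρ κ Vs ,, renKs ρ κ es)

  renE : (ℕ → ℕ) → (ℕ → ℕ) → Expr → Expr
  renE ρ κ (val V) = val (renV ρ κ V)
  renE ρ κ (mu c)  = mu (renC ρ (lift κ) c)
  renE ρ κ (esub v (Vs ,, es)) =
    esub (renE (liftN (length Vs) ρ) (liftN (length es) κ) v) (renVs ρ κ Vs ,, renKs ρ κ es)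

  renV : (ℕ → ℕ) → (ℕ → ℕ) → Val → Val
  renV ρ κ (var i)      = var (ρ i)
  renV ρ κ (pair V₁ V₂) = pair (renV ρ κ V₁) (renV ρ κ V₂)
  renV ρ κ (inl V)      = inl (renV ρ κ V)
  renV ρ κ (inr V)      = inr (renV ρ κ V)
  renV ρ κ (thunk e)    = thunk (renK ρ κ e)
  renV ρ κ (vsub V (Vs ,, es)) =
    vsub (renV (liftN (length Vs) ρ) (liftN (length es) κ) V) (renVs ρ κ Vs ,, renKs ρ κ es)

  renK : (ℕ → ℕ) → (ℕ → ℕ) → Ctx → Ctx
  renK ρ κ (covar j)      = covar (κ j)
  renK ρ κ (mut c)        = mut (renC (lift ρ) κ c)
  renK ρ κ (mutneg c)     = mutneg (renC ρ (lift κ) c)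
  renK ρ κ (mupair c)     = mupair (renC (lift (lift ρ)) κ c)
  renK ρ κ (mucase c₁ c₂) = mucase (renC (lift ρ) κ c₁) (renC (lift ρ) κ c₂)
  renK ρ κ (ksub e (Vs ,, es)) =
    ksub (renK (liftN (length Vs) ρ) (liftN (length es) κ) e) (renVs ρ κ Vs ,, renKs ρ κ es)

  renVs : (ℕ → ℕ) → (ℕ → ℕ) → List Val → List Val
  renVs ρ κ []       = []
  renVs ρ κ (V ∷ Vs) = renV ρ κ V ∷ renVs ρ κ Vs

  renKs : (ℕ → ℕ) → (ℕ → ℕ) → List Ctx → List Ctx
  renKs ρ κ []       = []
  renKs ρ κ (e ∷ es) = renK ρ κ e ∷ renKs ρ κ es

renS : (ℕ → ℕ) → (ℕ → ℕ) → Subst → Subst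
renS ρ κ (Vs ,, es) = renVs ρ κ Vs ,, renKs ρ κ es

idℕ : ℕ → ℕ
idℕ i = i

wkVar : ℕ → Subst → Subst
wkVar n = renS (n +_) idℕ

wkCovar : ℕ → Subst → Subst
wkCovar n = renS idℕ (n +_)

-- Typing of LKQ.  Γ (hypotheses, value variables) and Δ (conclusions,
-- co-variables) are lists; index i refers to the i-th entry.
-- Weakening is implicit (axioms pick any entry).

mutual
  data CmdTy (Γ Δ : List Formula) : Cmd → Set where
    cutT  : ∀ {v e P} → ExpTy Γ Δ v P → CtxTy Γ Δ e P → CmdTy Γ Δ ⟨ v ∣ e ⟩
    csubT : ∀ {c Vs es Ps Qs} → ValsTy Γ Δ Vs Ps → CtxsTy Γ Δ es Qs →
            CmdTy (Ps ++ Γ) (Qs ++ Δ) c → CmdTy Γ Δ (csub c (Vs ,, es))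

  data ExpTy (Γ Δ : List Formula) : Expr → Formula → Set where
    valT  : ∀ {V P} → ValTy Γ Δ V P → ExpTy Γ Δ (val V) P
    muT   : ∀ {c P} → CmdTy Γ (P ∷ Δ) c → ExpTy Γ Δ (mu c) P
    esubT : ∀ {v P Vs es Ps Qs} → ValsTy Γ Δ Vs Ps → CtxsTy Γ Δ es Qs →
            ExpTy (Ps ++ Γ) (Qs ++ Δ) v P → ExpTy Γ Δ (esub v (Vs ,, es)) P

  data ValTy (Γ Δ : List Formula) : Val → Formula → Set where
    varT   : ∀ {i P} → nth Γ i ≡ just P → ValTy Γ Δ (var i) P
    pairT  : ∀ {V₁ V₂ P₁ P₂} → ValTy Γ Δ V₁ P₁ → ValTy Γ Δ V₂ P₂ →
             ValTy Γ Δ (pair V₁ V₂) (P₁ ⊗ P₂)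
    inlT   : ∀ {V P₁ P₂} → ValTy Γ Δ V P₁ → ValTy Γ Δ (inl V) (P₁ ⊕ P₂)
    inrT   : ∀ {V P₁ P₂} → ValTy Γ Δ V P₂ → ValTy Γ Δ (inr V) (P₁ ⊕ P₂)
    thunkT : ∀ {e P} → CtxTy Γ Δ e P → ValTy Γ Δ (thunk e) (neg P)
    vsubT  : ∀ {V P Vs es Ps Qs} → ValsTy Γ Δ Vs Ps → CtxsTy Γ Δ es Qs →
             ValTy (Ps ++ Γ) (Qs ++ Δ) V P → ValTy Γ Δ (vsub V (Vs ,, es)) P

  data CtxTy (Γ Δ : List Formula) : Ctx → Formula → Set where
    covarT  : ∀ {j P} → nth Δ j ≡ just P → CtxTy Γ Δ (covar j) P
    mutT    : ∀ {c P} → CmdTy (P ∷ Γ) Δ c → CtxTy Γ Δ (mut c) P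
    mutnegT : ∀ {c P} → CmdTy Γ (P ∷ Δ) c → CtxTy Γ Δ (mutneg c) (neg P)
    mupairT : ∀ {c P₁ P₂} → CmdTy (P₁ ∷ P₂ ∷ Γ) Δ c → CtxTy Γ Δ (mupair c) (P₁ ⊗ P₂)
    mucaseT : ∀ {c₁ c₂ P₁ P₂} → CmdTy (P₁ ∷ Γ) Δ c₁ → CmdTy (P₂ ∷ Γ) Δ c₂ →
              CtxTy Γ Δ (mucase c₁ c₂) (P₁ ⊕ P₂)
    ksubT   : ∀ {e P Vs es Ps Qs} → ValsTy Γ Δ Vs Ps → CtxsTy Γ Δ es Qs →
              CtxTy (Ps ++ Γ) (Qs ++ Δ) e P → CtxTy Γ Δ (ksub e (Vs ,, es)) P

  data ValsTy (Γ Δ : List Formula) : List Val → List Formula → Set where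
    []  : ValsTy Γ Δ [] []
    _∷_ : ∀ {V Vs P Ps} → ValTy Γ Δ V P → ValsTy Γ Δ Vs Ps → ValsTy Γ Δ (V ∷ Vs) (P ∷ Ps)

  data CtxsTy (Γ Δ : List Formula) : List Ctx → List Formula → Set where
    []  : CtxsTy Γ Δ [] []
    _∷_ : ∀ {e es P Ps} → CtxTy Γ Δ e P → CtxsTy Γ Δ es Ps → CtxsTy Γ Δ (e ∷ es) (P ∷ Ps)

mutual
  data _⟶c_ : Cmd → Cmd → Set where
    βμ    : ∀ {c e} → ⟨ mu c ∣ e ⟩ ⟶c csub c ([] ,, e ∷ [])
    βμ̃    : ∀ {V c} → ⟨ val V ∣ mut c ⟩ ⟶c csub c (V ∷ [] ,, [])
    β¬    : ∀ {e c} → ⟨ val (thunk e) ∣ mutneg c ⟩ ⟶c csub c ([] ,, e ∷ [])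
    β⊗    : ∀ {V₁ V₂ c} → ⟨ val (pair V₁ V₂) ∣ mupair c ⟩ ⟶c csub c (V₁ ∷ V₂ ∷ [] ,, [])
    βinl  : ∀ {V c₁ c₂} → ⟨ val (inl V) ∣ mucase c₁ c₂ ⟩ ⟶c csub c₁ (V ∷ [] ,, [])
    βinr  : ∀ {V c₁ c₂} → ⟨ val (inr V) ∣ mucase c₁ c₂ ⟩ ⟶c csub c₂ (V ∷ [] ,, [])
    σcut  : ∀ {v e σ} → csub ⟨ v ∣ e ⟩ σ ⟶c ⟨ esub v σ ∣ ksub e σ ⟩
    ξcutˡ : ∀ {v v' e} → v ⟶e v' → ⟨ v ∣ e ⟩ ⟶c ⟨ v' ∣ e ⟩
    ξcutʳ : ∀ {v e e'} → e ⟶k e' → ⟨ v ∣ e ⟩ ⟶c ⟨ v ∣ e' ⟩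
    ξsubˡ : ∀ {c c' σ} → c ⟶c c' → csub c σ ⟶c csub c' σ
    ξsubʳ : ∀ {c σ σ'} → σ ⟶s σ' → csub c σ ⟶c csub c σ'

  data _⟶e_ : Expr → Expr → Set where
    σval  : ∀ {V σ} → esub (val V) σ ⟶e val (vsub V σ)
    σmu   : ∀ {c σ} → esub (mu c) σ ⟶e mu (csub (renC idℕ (rot 1 (lenK σ)) c) (wkCovar 1 σ))
    ξval  : ∀ {V V'} → V ⟶v V' → val V ⟶e val V'
    ξmu   : ∀ {c c'} → c ⟶c c' → mu c ⟶e mu c'
    ξsubˡ : ∀ {v v' σ} → v ⟶e v' → esub v σ ⟶e esub v' σ
    ξsubʳ : ∀ {v σ σ'} → σ ⟶s σ' → esub v σ ⟶e esub v σ'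

  data _⟶v_ : Val → Val → Set where
    σvar∈  : ∀ {i Vs es V} → nth Vs i ≡ just V → vsub (var i) (Vs ,, es) ⟶v V
    σvar∉  : ∀ {i Vs es} → length Vs ≤ i → vsub (var i) (Vs ,, es) ⟶v var (i ∸ length Vs)
    σpair  : ∀ {V₁ V₂ σ} → vsub (pair V₁ V₂) σ ⟶v pair (vsub V₁ σ) (vsub V₂ σ)
    σinl   : ∀ {V σ} → vsub (inl V) σ ⟶v inl (vsub V σ)
    σinr   : ∀ {V σ} → vsub (inr V) σ ⟶v inr (vsub V σ)
    σthunk : ∀ {e σ} → vsub (thunk e) σ ⟶v thunk (ksub e σ)
    ξpairˡ : ∀ {V₁ V₁' V₂} → V₁ ⟶v V₁' → pair V₁ V₂ ⟶v pair V₁' V₂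
    ξpairʳ : ∀ {V₁ V₂ V₂'} → V₂ ⟶v V₂' → pair V₁ V₂ ⟶v pair V₁ V₂'
    ξinl   : ∀ {V V'} → V ⟶v V' → inl V ⟶v inl V'
    ξinr   : ∀ {V V'} → V ⟶v V' → inr V ⟶v inr V'
    ξthunk : ∀ {e e'} → e ⟶k e' → thunk e ⟶v thunk e'
    ξsubˡ  : ∀ {V V' σ} → V ⟶v V' → vsub V σ ⟶v vsub V' σ
    ξsubʳ  : ∀ {V σ σ'} → σ ⟶s σ' → vsub V σ ⟶v vsub V σ'

  data _⟶k_ : Ctx → Ctx → Set where
    σcovar∈ : ∀ {j Vs es e} → nth es j ≡ just e → ksub (covar j) (Vs ,, es) ⟶k e
    σcovar∉ : ∀ {j Vs es} → length es ≤ j → ksub (covar j) (Vs ,, es) ⟶k covar (j ∸ length es)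
    σmut    : ∀ {c σ} → ksub (mut c) σ ⟶k mut (csub (renC (rot 1 (lenV σ)) idℕ c) (wkVar 1 σ))
    σmutneg : ∀ {c σ} → ksub (mutneg c) σ ⟶k mutneg (csub (renC idℕ (rot 1 (lenK σ)) c) (wkCovar 1 σ))
    σmupair : ∀ {c σ} → ksub (mupair c) σ ⟶k mupair (csub (renC (rot 2 (lenV σ)) idℕ c) (wkVar 2 σ))
    σmucase : ∀ {c₁ c₂ σ} → ksub (mucase c₁ c₂) σ ⟶k
              mucase (csub (renC (rot 1 (lenV σ)) idℕ c₁) (wkVar 1 σ))
                     (csub (renC (rot 1 (lenV σ)) idℕ c₂) (wkVar 1 σ))
    ξmut     : ∀ {c c'} → c ⟶c c' → mut c ⟶k mut c'
    ξmutneg  : ∀ {c c'} → c ⟶c c' → mutneg c ⟶k mutneg c'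
    ξmupair  : ∀ {c c'} → c ⟶c c' → mupair c ⟶k mupair c'
    ξmucaseˡ : ∀ {c₁ c₁' c₂} → c₁ ⟶c c₁' → mucase c₁ c₂ ⟶k mucase c₁' c₂
    ξmucaseʳ : ∀ {c₁ c₂ c₂'} → c₂ ⟶c c₂' → mucase c₁ c₂ ⟶k mucase c₁ c₂'
    ξsubˡ    : ∀ {e e' σ} → e ⟶k e' → ksub e σ ⟶k ksub e' σ
    ξsubʳ    : ∀ {e σ σ'} → σ ⟶s σ' → ksub e σ ⟶k ksub e σ'

  data _⟶s_ : Subst → Subst → Set where
    ξVs : ∀ {Vs Vs' es} → Vs ⟶vs Vs' → (Vs ,, es) ⟶s (Vs' ,, es)
    ξes : ∀ {Vs es es'} → es ⟶ks es' → (Vs ,, es) ⟶s (Vs ,, es')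

  data _⟶vs_ : List Val → List Val → Set where
    here  : ∀ {V V' Vs} → V ⟶v V' → (V ∷ Vs) ⟶vs (V' ∷ Vs)
    there : ∀ {V Vs Vs'} → Vs ⟶vs Vs' → (V ∷ Vs) ⟶vs (V ∷ Vs')

  data _⟶ks_ : List Ctx → List Ctx → Set where
    here  : ∀ {e e' es} → e ⟶k e' → (e ∷ es) ⟶ks (e' ∷ es)
    there : ∀ {e es es'} → es ⟶ks es' → (e ∷ es) ⟶ks (e ∷ es')

NormalC : Cmd → Set
NormalC c = ∀ {c'} → ¬ (c ⟶c c')

NormalE : Expr → Set
NormalE v = ∀ {v'} → ¬ (v ⟶e v')

NormalV : Val → Set
NormalV V = ∀ {V'} → ¬ (V ⟶v V')

NormalK : Ctx → Set
NormalK e = ∀ {e'} → ¬ (e ⟶k e')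

mutual
  data CutFreeC : Cmd → Set where
    cfAx   : ∀ {V j} → CutFreeV V → CutFreeC ⟨ val V ∣ covar j ⟩
    cfNeg  : ∀ {i c} → CutFreeC c → CutFreeC ⟨ val (var i) ∣ mutneg c ⟩
    cfPair : ∀ {i c} → CutFreeC c → CutFreeC ⟨ val (var i) ∣ mupair c ⟩
    cfCase : ∀ {i c₁ c₂} → CutFreeC c₁ → CutFreeC c₂ → CutFreeC ⟨ val (var i) ∣ mucase c₁ c₂ ⟩

  data CutFreeE : Expr → Set where
    cfVal : ∀ {V} → CutFreeV V → CutFreeE (val V)
    cfMu  : ∀ {c} → CutFreeC c → CutFreeE (mu c)

  data CutFreeV : Val → Set where
    cfVar   : ∀ {i} → CutFreeV (var i)
    cfPairV : ∀ {V₁ V₂} → CutFreeV V₁ → CutFreeV V₂ → CutFreeV (pair V₁ V₂)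
    cfInl   : ∀ {V} → CutFreeV V → CutFreeV (inl V)
    cfInr   : ∀ {V} → CutFreeV V → CutFreeV (inr V)
    cfThunk : ∀ {e} → CutFreeK e → CutFreeV (thunk e)

  data CutFreeK : Ctx → Set where
    cfCovar  : ∀ {j} → CutFreeK (covar j)
    cfMut    : ∀ {c} → CutFreeC c → CutFreeK (mut c)
    cfMutneg : ∀ {c} → CutFreeC c → CutFreeK (mutneg c)
    cfMupair : ∀ {c} → CutFreeC c → CutFreeK (mupair c)
    cfMucase : ∀ {c₁ c₂} → CutFreeC c₁ → CutFreeC c₂ → CutFreeK (mucase c₁ c₂)

module Submission where

-- Cut elimination for LKQ by hereditary substitution.
--
-- Every term is normalised bottom-up.  The only non-structural step is to
-- apply a cut-free substitution σ to a cut-free term t.  Pushing σ through t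
-- by the commutation rules creates new cuts, which are eliminated at once:
-- a substituted value meeting a matching context μ̃α•.c, μ̃(x₁,x₂).c or
-- μ̃[…] gives a logical cut, whose logical step leaves a substitution at a
-- formula of strictly smaller rank; a substituted context e meeting a value
-- V gives a cut of the same rank, eliminated by cutVal: logically, or, when
-- e = μ̃x.c, by substituting V into c -- a substitution without co-variables,
-- which therefore only creates logical cuts.  So hereditary substitution
-- (hsubC, …) terminates by lexicographic induction on the rank of σ and the
-- size of t.  The size is needed as fuel because pushing σ under a binder
-- renames the body, and renaming preserves the size of cut-free terms.

open import Defs
open import Data.Empty using (⊥)
open import Data.Bool using (true; false; if_then_else_)
open import Data.List using (List; []; _∷_; _++_; length)
open import Data.List.Relation.Unary.All using (All; []; _∷_)
import Data.List.Relation.Unary.All as All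
open import Data.Maybe using (just)
open import Data.Nat using (ℕ; zero; suc; _+_; _∸_; _≤_; _<_; _<ᵇ_; z≤n; s≤s; z<s; s<s)
open import Data.Nat.Properties
  using (+-suc; +-comm; m+n∸m≡n; ≤-refl; <⇒≤; m+n≤o⇒m≤o; m+n≤o⇒n≤o; m≤m+n; m≤n+m)
open import Data.Product using (Σ; _×_; _,_)
open import Data.Sum using (_⊎_; inj₁; inj₂)
open import Data.Unit using (⊤; tt)
open import Relation.Binary.Construct.Closure.ReflexiveTransitive
  using (Star; ε; _◅_; _◅◅_; gmap)
open import Relation.Binary.PropositionalEquality
  using (_≡_; refl; sym; trans; cong; cong₂; subst)

-- Size of a term, with explicit substitutions counting 0.  On cut-free
-- terms it is invariant under renaming, which makes it the fuel of
-- hereditary substitution: that recursion descends into renamed subterms.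
mutual
  szC : Cmd → ℕ
  szC ⟨ v ∣ e ⟩  = suc (szE v + szK e)
  szC (csub _ _) = 0

  szE : Expr → ℕ
  szE (val V)    = suc (szV V)
  szE (mu c)     = suc (szC c)
  szE (esub _ _) = 0

  szV : Val → ℕ
  szV (var _)      = 1
  szV (pair V₁ V₂) = suc (szV V₁ + szV V₂)
  szV (inl V)      = suc (szV V)
  szV (inr V)      = suc (szV V)
  szV (thunk e)    = suc (szK e)
  szV (vsub _ _)   = 0

  szK : Ctx → ℕ
  szK (covar _)      = 1
  szK (mut c)        = suc (szC c)
  szK (mutneg c)     = suc (szC c)
  szK (mupair c)     = suc (szC c)
  szK (mucase c₁ c₂) = suc (szC c₁ + szC c₂)
  szK (ksub _ _)     = 0

mutual
  szRenC : ∀ {ρ κ c} → CutFreeC c → szC (renC ρ κ c) ≡ szC c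
  szRenC (cfAx cV)       = cong (λ x → suc (suc x + 1)) (szRenV cV)
  szRenC (cfNeg cc)      = cong (λ x → suc (2 + suc x)) (szRenC cc)
  szRenC (cfPair cc)     = cong (λ x → suc (2 + suc x)) (szRenC cc)
  szRenC (cfCase c₁ c₂) = cong₂ (λ x y → suc (2 + suc (x + y))) (szRenC c₁) (szRenC c₂)

  szRenV : ∀ {ρ κ V} → CutFreeV V → szV (renV ρ κ V) ≡ szV V
  szRenV cfVar          = refl
  szRenV (cfPairV a b)  = cong₂ (λ x y → suc (x + y)) (szRenV a) (szRenV b)
  szRenV (cfInl a)      = cong suc (szRenV a)
  szRenV (cfInr a)      = cong suc (szRenV a)
  szRenV (cfThunk k)    = cong suc (szRenK k)

  szRenK : ∀ {ρ κ e} → CutFreeK e → szK (renK ρ κ e) ≡ szK e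
  szRenK cfCovar          = refl
  szRenK (cfMut c)        = cong suc (szRenC c)
  szRenK (cfMutneg c)     = cong suc (szRenC c)
  szRenK (cfMupair c)     = cong suc (szRenC c)
  szRenK (cfMucase c₁ c₂) = cong₂ (λ x y → suc (x + y)) (szRenC c₁) (szRenC c₂)

mutual
  renCFC : ∀ {ρ κ c} → CutFreeC c → CutFreeC (renC ρ κ c)
  renCFC (cfAx cV)       = cfAx (renCFV cV)
  renCFC (cfNeg cc)      = cfNeg (renCFC cc)
  renCFC (cfPair cc)     = cfPair (renCFC cc)
  renCFC (cfCase c₁ c₂) = cfCase (renCFC c₁) (renCFC c₂)

  renCFV : ∀ {ρ κ V} → CutFreeV V → CutFreeV (renV ρ κ V)
  renCFV cfVar         = cfVar
  renCFV (cfPairV a b) = cfPairV (renCFV a) (renCFV b)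
  renCFV (cfInl a)     = cfInl (renCFV a)
  renCFV (cfInr a)     = cfInr (renCFV a)
  renCFV (cfThunk k)   = cfThunk (renCFK k)

  renCFK : ∀ {ρ κ e} → CutFreeK e → CutFreeK (renK ρ κ e)
  renCFK cfCovar          = cfCovar
  renCFK (cfMut c)        = cfMut (renCFC c)
  renCFK (cfMutneg c)     = cfMutneg (renCFC c)
  renCFK (cfMupair c)     = cfMupair (renCFC c)
  renCFK (cfMucase c₁ c₂) = cfMucase (renCFC c₁) (renCFC c₂)

renCFVs : ∀ {ρ κ Vs} → All CutFreeV Vs → All CutFreeV (renVs ρ κ Vs)
renCFVs []       = []
renCFVs (c ∷ cs) = renCFV c ∷ renCFVs cs

renCFKs : ∀ {ρ κ es} → All CutFreeK es → All CutFreeK (renKs ρ κ es)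
renCFKs []       = []
renCFKs (c ∷ cs) = renCFK c ∷ renCFKs cs

szRen≤ : ∀ {ρ κ c n} → CutFreeC c → szC c ≤ n → szC (renC ρ κ c) ≤ n
szRen≤ {n = n} cc sz = subst (_≤ n) (sym (szRenC cc)) sz

nth-++ʳ : ∀ {A : Set} (X : List A) {Y} i → nth (X ++ Y) (length X + i) ≡ nth Y i
nth-++ʳ []      i = refl
nth-++ʳ (x ∷ X) i = nth-++ʳ X i

nth-++ˡ : ∀ {A : Set} (X : List A) {Y Z i} → i < length X → nth (X ++ Y) i ≡ nth (X ++ Z) i
nth-++ˡ (x ∷ X) {i = zero}  _         = refl
nth-++ˡ (x ∷ X) {i = suc i} (s≤s i<X) = nth-++ˡ X i<X

record TyRen (ρ : ℕ → ℕ) (Γ Γ' : List Formula) : Set where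
  constructor tyren
  field app : ∀ {i P} → nth Γ i ≡ just P → nth Γ' (ρ i) ≡ just P
open TyRen

idTy : ∀ {Γ} → TyRen idℕ Γ Γ
idTy = tyren (λ eq → eq)

liftTy : ∀ {ρ Γ Γ' A} → TyRen ρ Γ Γ' → TyRen (lift ρ) (A ∷ Γ) (A ∷ Γ')
liftTy {ρ} {Γ} {Γ'} {A} r = tyren (λ {i} → go {i})
  where
  go : ∀ {i P} → nth (A ∷ Γ) i ≡ just P → nth (A ∷ Γ') (lift ρ i) ≡ just P
  go {zero}  eq = eq
  go {suc i} eq = app r eq

wkTy : ∀ (As : List Formula) {Γ} → TyRen (length As +_) Γ (As ++ Γ)
wkTy As = tyren (λ {i} eq → trans (nth-++ʳ As i) eq)

-- The commutation rules push σ under n binders by renaming the body with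
-- rot n k (k = length of σ).  rotTy below shows this is a typed renaming;
-- the lemmas up to it compute rot on the two relevant ranges of indices.
-- First, i ↦ i below k, i ↦ m + i from k on: the renaming for inserting m
-- entries at position k.
shiftAbove : ℕ → ℕ → ℕ → ℕ
shiftAbove k m i = if i <ᵇ k then i else m + i

shiftAbove-suc : ∀ k m i → shiftAbove (suc k) m (suc i) ≡ suc (shiftAbove k m i)
shiftAbove-suc k m i with i <ᵇ k
... | true  = refl
... | false = +-suc m i

nth-insert : ∀ {A : Set} (Ps X : List A) {Γ i P} → nth (Ps ++ Γ) i ≡ just P →
             nth (Ps ++ X ++ Γ) (shiftAbove (length Ps) (length X) i) ≡ just P
nth-insert []       X {i = i}     eq = trans (nth-++ʳ X i) eq
nth-insert (R ∷ Ps) X {i = zero}  eq = eq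
nth-insert (R ∷ Ps) X {i = suc i} eq
  rewrite shiftAbove-suc (length Ps) (length X) i = nth-insert Ps X eq

data Split (n : ℕ) : ℕ → Set where
  below : ∀ {i} → i < n → Split n i
  above : ∀ j → Split n (n + j)

split : ∀ n i → Split n i
split zero    i       = above i
split (suc n) zero    = below z<s
split (suc n) (suc i) with split n i
... | below i<n = below (s<s i<n)
... | above j   = above j

<ᵇ-true : ∀ {i n} → i < n → (i <ᵇ n) ≡ true
<ᵇ-true {zero}  {suc n} _         = refl
<ᵇ-true {suc i} {suc n} (s≤s i<n) = <ᵇ-true i<n

+<ᵇ-false : ∀ n j → (n + j <ᵇ n) ≡ false
+<ᵇ-false zero    j = refl
+<ᵇ-false (suc n) j = +<ᵇ-false n j

+<ᵇ+ : ∀ n j k → (n + j <ᵇ n + k) ≡ (j <ᵇ k)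
+<ᵇ+ zero    j k = refl
+<ᵇ+ (suc n) j k = +<ᵇ+ n j k

rot-below : ∀ {n i} k → i < n → rot n k i ≡ i + k
rot-below k p rewrite <ᵇ-true p = refl

rot-above : ∀ n k j → rot n k (n + j) ≡ shiftAbove k n j
rot-above n k j rewrite +<ᵇ-false n j | +<ᵇ+ n j k | m+n∸m≡n n j = refl

rotTy : ∀ (As Ps : List Formula) {Γ k} → length Ps ≡ k →
        TyRen (rot (length As) k) (As ++ Ps ++ Γ) (Ps ++ As ++ Γ)
rotTy As Ps {Γ} refl = tyren (λ {i} → go (split (length As) i))
  where
  go : ∀ {i P} → Split (length As) i → nth (As ++ Ps ++ Γ) i ≡ just P →
       nth (Ps ++ As ++ Γ) (rot (length As) (length Ps) i) ≡ just P
  go {i} (below p) eq rewrite rot-below (length Ps) p =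
    trans (cong (nth (Ps ++ As ++ Γ)) (+-comm i (length Ps)))
          (trans (nth-++ʳ Ps i) (trans (nth-++ˡ As p) eq))
  go (above j) eq rewrite rot-above (length As) (length Ps) j =
    nth-insert Ps As (trans (sym (nth-++ʳ As j)) eq)

mutual
  renTyC : ∀ {ρ κ Γ Γ' Δ Δ' c} → CutFreeC c → TyRen ρ Γ Γ' → TyRen κ Δ Δ' →
           CmdTy Γ Δ c → CmdTy Γ' Δ' (renC ρ κ c)
  renTyC (cfAx cV) r k (cutT (valT tV) (covarT eq)) =
    cutT (valT (renTyV cV r k tV)) (covarT (app k eq))
  renTyC (cfNeg cc) r k (cutT (valT (varT eq)) (mutnegT tc)) =
    cutT (valT (varT (app r eq))) (mutnegT (renTyC cc r (liftTy k) tc))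
  renTyC (cfPair cc) r k (cutT (valT (varT eq)) (mupairT tc)) =
    cutT (valT (varT (app r eq))) (mupairT (renTyC cc (liftTy (liftTy r)) k tc))
  renTyC (cfCase c₁ c₂) r k (cutT (valT (varT eq)) (mucaseT t₁ t₂)) =
    cutT (valT (varT (app r eq)))
         (mucaseT (renTyC c₁ (liftTy r) k t₁) (renTyC c₂ (liftTy r) k t₂))

  renTyV : ∀ {ρ κ Γ Γ' Δ Δ' V P} → CutFreeV V → TyRen ρ Γ Γ' → TyRen κ Δ Δ' →
           ValTy Γ Δ V P → ValTy Γ' Δ' (renV ρ κ V) P
  renTyV cfVar         r k (varT eq)     = varT (app r eq)
  renTyV (cfPairV a b) r k (pairT ta tb) = pairT (renTyV a r k ta) (renTyV b r k tb)
  renTyV (cfInl a)     r k (inlT t)      = inlT (renTyV a r k t)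
  renTyV (cfInr a)     r k (inrT t)      = inrT (renTyV a r k t)
  renTyV (cfThunk a)   r k (thunkT t)    = thunkT (renTyK a r k t)

  renTyK : ∀ {ρ κ Γ Γ' Δ Δ' e P} → CutFreeK e → TyRen ρ Γ Γ' → TyRen κ Δ Δ' →
           CtxTy Γ Δ e P → CtxTy Γ' Δ' (renK ρ κ e) P
  renTyK cfCovar          r k (covarT eq)     = covarT (app k eq)
  renTyK (cfMut c)        r k (mutT t)        = mutT (renTyC c (liftTy r) k t)
  renTyK (cfMutneg c)     r k (mutnegT t)     = mutnegT (renTyC c r (liftTy k) t)
  renTyK (cfMupair c)     r k (mupairT t)     = mupairT (renTyC c (liftTy (liftTy r)) k t)
  renTyK (cfMucase c₁ c₂) r k (mucaseT t₁ t₂) =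
    mucaseT (renTyC c₁ (liftTy r) k t₁) (renTyC c₂ (liftTy r) k t₂)

renTyVs : ∀ {ρ κ Γ Γ' Δ Δ' Vs Ps} → All CutFreeV Vs → TyRen ρ Γ Γ' → TyRen κ Δ Δ' →
          ValsTy Γ Δ Vs Ps → ValsTy Γ' Δ' (renVs ρ κ Vs) Ps
renTyVs []       r k []       = []
renTyVs (c ∷ cs) r k (t ∷ ts) = renTyV c r k t ∷ renTyVs cs r k ts

renTyKs : ∀ {ρ κ Γ Γ' Δ Δ' es Ps} → All CutFreeK es → TyRen ρ Γ Γ' → TyRen κ Δ Δ' →
          CtxsTy Γ Δ es Ps → CtxsTy Γ' Δ' (renKs ρ κ es) Ps
renTyKs []       r k []       = []
renTyKs (c ∷ cs) r k (t ∷ ts) = renTyK c r k t ∷ renTyKs cs r k ts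

lenVs : ∀ {Γ Δ Vs Ps} → ValsTy Γ Δ Vs Ps → length Vs ≡ length Ps
lenVs []       = refl
lenVs (_ ∷ ts) = cong suc (lenVs ts)

lenKs : ∀ {Γ Δ es Qs} → CtxsTy Γ Δ es Qs → length es ≡ length Qs
lenKs []       = refl
lenKs (_ ∷ ts) = cong suc (lenKs ts)

-- Rank≤ r P: the connectives of P are nested at most r deep.  A logical
-- reduction step on a cut formula of rank ≤ suc r produces substitutions
-- whose formulas have rank ≤ r.
Rank≤ : ℕ → Formula → Set
Rank≤ n       (atom x) = ⊤
Rank≤ zero    (P ⊗ Q)  = ⊥
Rank≤ zero    (P ⊕ Q)  = ⊥
Rank≤ zero    (neg P)  = ⊥
Rank≤ (suc n) (P ⊗ Q)  = Rank≤ n P × Rank≤ n Q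
Rank≤ (suc n) (P ⊕ Q)  = Rank≤ n P × Rank≤ n Q
Rank≤ (suc n) (neg P)  = Rank≤ n P

conns : Formula → ℕ
conns (atom x) = 0
conns (P ⊗ Q)  = suc (conns P + conns Q)
conns (P ⊕ Q)  = suc (conns P + conns Q)
conns (neg P)  = suc (conns P)

rank≤conns : ∀ P {n} → conns P ≤ n → Rank≤ n P
rank≤conns (atom x) h                = tt
rank≤conns (P ⊗ Q)  {suc n} (s≤s h) =
  rank≤conns P (m+n≤o⇒m≤o (conns P) h) , rank≤conns Q (m+n≤o⇒n≤o (conns P) h)
rank≤conns (P ⊕ Q)  {suc n} (s≤s h) =
  rank≤conns P (m+n≤o⇒m≤o (conns P) h) , rank≤conns Q (m+n≤o⇒n≤o (conns P) h)
rank≤conns (neg P)  {suc n} (s≤s h) = rank≤conns P h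

connsL : List Formula → ℕ
connsL []       = 0
connsL (P ∷ Ps) = conns P + connsL Ps

allRank≤ : ∀ Ps {n} → connsL Ps ≤ n → All (Rank≤ n) Ps
allRank≤ []       h = []
allRank≤ (P ∷ Ps) h =
  rank≤conns P (m+n≤o⇒m≤o (conns P) h) ∷ allRank≤ Ps (m+n≤o⇒n≤o (conns P) h)

rankOf : List Formula → List Formula → ℕ
rankOf Ps Qs = connsL Ps + connsL Qs

-- σ = (Vs ,, es) is a cut-free substitution for Ps / Qs over Γ / Δ whose
-- formulas have rank ≤ r; moreover the formulas Qs of its co-variables
-- satisfy Cuttable (which lets ⊥ express "no co-variables").
record CutFreeSub (r : ℕ) (Cuttable : Formula → Set) (Γ Δ : List Formula)
                  (Vs : List Val) (es : List Ctx) (Ps Qs : List Formula) : Set where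
  constructor sub
  field
    valsTy   : ValsTy Γ Δ Vs Ps
    ctxsTy   : CtxsTy Γ Δ es Qs
    valsCF   : All CutFreeV Vs
    ctxsCF   : All CutFreeK es
    valsRank : All (Rank≤ r) Ps
    ctxsRank : All (λ Q → Rank≤ r Q × Cuttable Q) Qs
open CutFreeSub

renSub : ∀ {ρ κ r Cuttable Γ Γ' Δ Δ' Vs es Ps Qs} → TyRen ρ Γ Γ' → TyRen κ Δ Δ' →
         CutFreeSub r Cuttable Γ Δ Vs es Ps Qs →
         CutFreeSub r Cuttable Γ' Δ' (renVs ρ κ Vs) (renKs ρ κ es) Ps Qs
renSub r k (sub vt kt vc kc vb kb) =
  sub (renTyVs vc r k vt) (renTyKs kc r k kt) (renCFVs vc) (renCFKs kc) vb kb

valSub : ∀ {r Cuttable Γ Δ V P} → ValTy Γ Δ V P → CutFreeV V → Rank≤ r P →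
         CutFreeSub r Cuttable Γ Δ (V ∷ []) [] (P ∷ []) []
valSub tV cV b = sub (tV ∷ []) [] (cV ∷ []) [] (b ∷ []) []

ctxSub : ∀ {r Γ Δ e Q} → CtxTy Γ Δ e Q → CutFreeK e → Rank≤ r Q →
         CutFreeSub r (λ _ → ⊤) Γ Δ [] (e ∷ []) [] (Q ∷ [])
ctxSub tE cE b = sub [] (tE ∷ []) [] (cE ∷ []) [] ((b , tt) ∷ [])

lookupV : ∀ {r Γ Δ Vs Ps P} i → ValsTy Γ Δ Vs Ps → All CutFreeV Vs → All (Rank≤ r) Ps →
          nth (Ps ++ Γ) i ≡ just P →
          (Σ Val λ W → nth Vs i ≡ just W × ValTy Γ Δ W P × CutFreeV W × Rank≤ r P)
          ⊎ (length Vs ≤ i × nth Γ (i ∸ length Vs) ≡ just P)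
lookupV i       []       []       []       eq   = inj₂ (z≤n , eq)
lookupV zero    (t ∷ ts) (c ∷ cs) (b ∷ bs) refl = inj₁ (_ , refl , t , c , b)
lookupV (suc i) (t ∷ ts) (c ∷ cs) (b ∷ bs) eq with lookupV i ts cs bs eq
... | inj₁ found       = inj₁ found
... | inj₂ (le , eq') = inj₂ (s≤s le , eq')

lookupK : ∀ {B : Formula → Set} {Γ Δ es Qs Q} j → CtxsTy Γ Δ es Qs → All CutFreeK es →
          All B Qs → nth (Qs ++ Δ) j ≡ just Q →
          (Σ Ctx λ e → nth es j ≡ just e × CtxTy Γ Δ e Q × CutFreeK e × B Q)
          ⊎ (length es ≤ j × nth Δ (j ∸ length es) ≡ just Q)
lookupK j       []       []       []       eq   = inj₂ (z≤n , eq)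
lookupK zero    (t ∷ ts) (c ∷ cs) (b ∷ bs) refl = inj₁ (_ , refl , t , c , b)
lookupK (suc j) (t ∷ ts) (c ∷ cs) (b ∷ bs) eq with lookupK j ts cs bs eq
... | inj₁ found       = inj₁ found
... | inj₂ (le , eq') = inj₂ (s≤s le , eq')

Reduct : {A : Set} → (A → A → Set) → (A → Set) → (A → Set) → A → Set
Reduct {A} _⟶_ Ty CF t = Σ A λ t' → Star _⟶_ t t' × Ty t' × CF t'

_▷_ : ∀ {A : Set} {R : A → A → Set} {Ty CF : A → Set} {t t₁} →
      Star R t t₁ → Reduct R Ty CF t₁ → Reduct R Ty CF t
s ▷ (t' , s' , ty , cf) = t' , s ◅◅ s' , ty , cf

ResC : List Formula → List Formula → Cmd → Set
ResC Γ Δ = Reduct _⟶c_ (CmdTy Γ Δ) CutFreeC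

ResE : List Formula → List Formula → Expr → Formula → Set
ResE Γ Δ v P = Reduct _⟶e_ (λ v' → ExpTy Γ Δ v' P) CutFreeE v

ResV : List Formula → List Formula → Val → Formula → Set
ResV Γ Δ V P = Reduct _⟶v_ (λ V' → ValTy Γ Δ V' P) CutFreeV V

ResK : List Formula → List Formula → Ctx → Formula → Set
ResK Γ Δ e P = Reduct _⟶k_ (λ e' → CtxTy Γ Δ e' P) CutFreeK e

-- Cut-free contexts that pattern-match on a value.  A cut of a variable
-- against one of them is cut-free; a cut of a constructed value is principal.
data Matching : Ctx → Set where
  mNeg  : ∀ {c} → CutFreeC c → Matching (mutneg c)
  mPair : ∀ {c} → CutFreeC c → Matching (mupair c)
  mCase : ∀ {c₁ c₂} → CutFreeC c₁ → CutFreeC c₂ → Matching (mucase c₁ c₂)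

stuckCut : ∀ {i e} → Matching e → CutFreeC ⟨ val (var i) ∣ e ⟩
stuckCut (mNeg cc)       = cfNeg cc
stuckCut (mPair cc)      = cfPair cc
stuckCut (mCase c₁ c₂)  = cfCase c₁ c₂

matchingReduct : ∀ {Γ Δ e P} →
                 (Σ Ctx λ e' → Star _⟶k_ e e' × CtxTy Γ Δ e' P × Matching e') → ResK Γ Δ e P
matchingReduct (e' , s , t , mNeg cc)      = e' , s , t , cfMutneg cc
matchingReduct (e' , s , t , mPair cc)     = e' , s , t , cfMupair cc
matchingReduct (e' , s , t , mCase c₁ c₂) = e' , s , t , cfMucase c₁ c₂

CutHandler : ℕ → (Formula → Set) → Set
CutHandler r Cuttable = ∀ {Γ Δ V e Q} → Cuttable Q → Rank≤ r Q → CutFreeV V → CutFreeK e →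
                        ValTy Γ Δ V Q → CtxTy Γ Δ e Q → ResC Γ Δ ⟨ val V ∣ e ⟩

-- Substitutions without co-variables never need to eliminate a cut.
noCut : ∀ {r} → CutHandler r (λ _ → ⊥)
noCut ()

pushIntoCut : ∀ {V V' e σ} → Star _⟶v_ (vsub V σ) V' →
              Star _⟶c_ (csub ⟨ val V ∣ e ⟩ σ) ⟨ val V' ∣ ksub e σ ⟩
pushIntoCut s = σcut ◅ ξcutˡ σval ◅ gmap (λ x → ⟨ val x ∣ _ ⟩) (λ r → ξcutˡ (ξval r)) s

mutual
  -- A cut ⟨W|e⟩ on a matching e: stuck when W is a variable; otherwise a
  -- logical step leaves a substitution at rank r into a cut-free body.
  logCut : ∀ r {Γ Δ W e P} → Rank≤ r P → CutFreeV W → ValTy Γ Δ W P → Matching e →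
           CtxTy Γ Δ e P → ResC Γ Δ ⟨ val W ∣ e ⟩
  logCut r b cfVar tW m tE = _ , ε , cutT (valT tW) tE , stuckCut m
  logCut (suc r) b (cfThunk ck) (thunkT tk) (mNeg cc) (mutnegT tc) =
    (β¬ ◅ ε) ▷ substC r (ctxSub tk ck b) cc tc
  logCut (suc r) (b₁ , b₂) (cfPairV c₁ c₂) (pairT t₁ t₂) (mPair cc) (mupairT tc) =
    (β⊗ ◅ ε) ▷ substC r (sub (t₁ ∷ t₂ ∷ []) [] (c₁ ∷ c₂ ∷ []) [] (b₁ ∷ b₂ ∷ []) []) cc tc
  logCut (suc r) (b₁ , b₂) (cfInl cV) (inlT tV) (mCase cc₁ cc₂) (mucaseT t₁ t₂) =
    (βinl ◅ ε) ▷ substC r (valSub tV cV b₁) cc₁ t₁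
  logCut (suc r) (b₁ , b₂) (cfInr cV) (inrT tV) (mCase cc₁ cc₂) (mucaseT t₁ t₂) =
    (βinr ◅ ε) ▷ substC r (valSub tV cV b₂) cc₂ t₂

  -- Eliminates every cut of a cut-free value against a cut-free context
  -- at rank ≤ r; against μ̃x.c the value is substituted without handler.
  cutVal : ∀ r → CutHandler r (λ _ → ⊤)
  cutVal r _ b cV cfCovar          tV tE        = _ , ε , cutT (valT tV) tE , cfAx cV
  cutVal r _ b cV (cfMut {c} cc)   tV (mutT tc) =
    (βμ̃ ◅ ε) ▷ hsubC r noCut (szC c) (valSub tV cV b) cc tc ≤-refl
  cutVal r _ b cV (cfMutneg cc)    tV tE        = logCut r b cV tV (mNeg cc) tE
  cutVal r _ b cV (cfMupair cc)    tV tE        = logCut r b cV tV (mPair cc) tE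
  cutVal r _ b cV (cfMucase c₁ c₂) tV tE        = logCut r b cV tV (mCase c₁ c₂) tE

  substC : ∀ r {Γ Δ Vs es Ps Qs c} → CutFreeSub r (λ _ → ⊤) Γ Δ Vs es Ps Qs →
           CutFreeC c → CmdTy (Ps ++ Γ) (Qs ++ Δ) c → ResC Γ Δ (csub c (Vs ,, es))
  substC r {c = c} σ cc tc = hsubC r (cutVal r) (szC c) σ cc tc ≤-refl

  hsubC : ∀ r {Cuttable} (h : CutHandler r Cuttable) n {Γ Δ Vs es Ps Qs c} →
          CutFreeSub r Cuttable Γ Δ Vs es Ps Qs → CutFreeC c → CmdTy (Ps ++ Γ) (Qs ++ Δ) c →
          szC c ≤ n → ResC Γ Δ (csub c (Vs ,, es))
  hsubC r h (suc n) σ (cfAx {V} {j} cV) (cutT (valT tV) (covarT jeq)) (s≤s sz)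
    with hsubV r h n σ cV tV (<⇒≤ (m+n≤o⇒m≤o (suc (szV V)) sz))
       | lookupK j (ctxsTy σ) (ctxsCF σ) (ctxsRank σ) jeq
  ... | V' , sV , tV' , cV' | inj₁ (e , eeq , tE , cE , b , ok) =
    (pushIntoCut sV ◅◅ (ξcutʳ (σcovar∈ eeq) ◅ ε)) ▷ h ok b cV' cE tV' tE
  ... | V' , sV , tV' , cV' | inj₂ (le , eq) =
    _ , pushIntoCut sV ◅◅ (ξcutʳ (σcovar∉ le) ◅ ε) , cutT (valT tV') (covarT eq) , cfAx cV'
  hsubC r h (suc n) σ (cfNeg cc) tc (s≤s sz) =
    hsubStuck r h n σ (mNeg cc) tc (m+n≤o⇒n≤o 2 sz)
  hsubC r h (suc n) σ (cfPair cc) tc (s≤s sz) =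
    hsubStuck r h n σ (mPair cc) tc (m+n≤o⇒n≤o 2 sz)
  hsubC r h (suc n) σ (cfCase c₁ c₂) tc (s≤s sz) =
    hsubStuck r h n σ (mCase c₁ c₂) tc (m+n≤o⇒n≤o 2 sz)

  hsubStuck : ∀ r {Cuttable} (h : CutHandler r Cuttable) n {Γ Δ Vs es Ps Qs i e} →
              CutFreeSub r Cuttable Γ Δ Vs es Ps Qs → Matching e →
              CmdTy (Ps ++ Γ) (Qs ++ Δ) ⟨ val (var i) ∣ e ⟩ → szK e ≤ n →
              ResC Γ Δ (csub ⟨ val (var i) ∣ e ⟩ (Vs ,, es))
  hsubStuck r h n {i = i} σ m (cutT (valT (varT ieq)) tE) sz
    with hsubMatching r h n σ m tE sz | lookupV i (valsTy σ) (valsCF σ) (valsRank σ) ieq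
  ... | e' , sE , tE' , m' | inj₁ (W , weq , tW , cW , b) =
    (pushIntoCut (σvar∈ weq ◅ ε) ◅◅ gmap (λ x → ⟨ val W ∣ x ⟩) ξcutʳ sE)
      ▷ logCut r b cW tW m' tE'
  ... | e' , sE , tE' , m' | inj₂ (le , eq) =
    _ , pushIntoCut (σvar∉ le ◅ ε) ◅◅ gmap (λ x → ⟨ val (var _) ∣ x ⟩) ξcutʳ sE ,
    cutT (valT (varT eq)) tE' , stuckCut m'

  hsubMatching : ∀ r {Cuttable} (h : CutHandler r Cuttable) n {Γ Δ Vs es Ps Qs e P} →
                 CutFreeSub r Cuttable Γ Δ Vs es Ps Qs → Matching e →
                 CtxTy (Ps ++ Γ) (Qs ++ Δ) e P → szK e ≤ n →
                 Σ Ctx λ e' → Star _⟶k_ (ksub e (Vs ,, es)) e' × CtxTy Γ Δ e' P × Matching e'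
  hsubMatching r h (suc n) σ (mNeg cc) (mutnegT tc) (s≤s sz)
    with hsubUnderK r h n (_ ∷ []) σ cc tc sz
  ... | c' , s , t , cf = mutneg c' , σmutneg ◅ gmap mutneg ξmutneg s , mutnegT t , mNeg cf
  hsubMatching r h (suc n) σ (mPair cc) (mupairT tc) (s≤s sz)
    with hsubUnderV r h n (_ ∷ _ ∷ []) σ cc tc sz
  ... | c' , s , t , cf = mupair c' , σmupair ◅ gmap mupair ξmupair s , mupairT t , mPair cf
  hsubMatching r h (suc n) σ (mCase {c₁} cc₁ cc₂) (mucaseT t₁ t₂) (s≤s sz)
    with hsubUnderV r h n (_ ∷ []) σ cc₁ t₁ (m+n≤o⇒m≤o (szC c₁) sz)
       | hsubUnderV r h n (_ ∷ []) σ cc₂ t₂ (m+n≤o⇒n≤o (szC c₁) sz)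
  ... | d₁ , s₁ , u₁ , f₁ | d₂ , s₂ , u₂ , f₂ =
    mucase d₁ d₂ , σmucase ◅ (gmap (λ x → mucase x _) ξmucaseˡ s₁ ◅◅ gmap (mucase d₁) ξmucaseʳ s₂) ,
    mucaseT u₁ u₂ , mCase f₁ f₂

  hsubV : ∀ r {Cuttable} (h : CutHandler r Cuttable) n {Γ Δ Vs es Ps Qs V P} →
          CutFreeSub r Cuttable Γ Δ Vs es Ps Qs → CutFreeV V → ValTy (Ps ++ Γ) (Qs ++ Δ) V P →
          szV V ≤ n → ResV Γ Δ (vsub V (Vs ,, es)) P
  hsubV r h n σ (cfVar {i}) (varT ieq) sz
    with lookupV i (valsTy σ) (valsCF σ) (valsRank σ) ieq
  ... | inj₁ (W , weq , tW , cW , _) = W , σvar∈ weq ◅ ε , tW , cW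
  ... | inj₂ (le , eq)               = _ , σvar∉ le ◅ ε , varT eq , cfVar
  hsubV r h (suc n) σ (cfPairV {V₁} c₁ c₂) (pairT t₁ t₂) (s≤s sz)
    with hsubV r h n σ c₁ t₁ (m+n≤o⇒m≤o (szV V₁) sz) | hsubV r h n σ c₂ t₂ (m+n≤o⇒n≤o (szV V₁) sz)
  ... | W₁ , s₁ , u₁ , d₁ | W₂ , s₂ , u₂ , d₂ =
    _ , σpair ◅ (gmap (λ x → pair x _) ξpairˡ s₁ ◅◅ gmap (pair W₁) ξpairʳ s₂) ,
    pairT u₁ u₂ , cfPairV d₁ d₂
  hsubV r h (suc n) σ (cfInl cV) (inlT tV) (s≤s sz) with hsubV r h n σ cV tV sz
  ... | W , s , u , d = _ , σinl ◅ gmap inl ξinl s , inlT u , cfInl d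
  hsubV r h (suc n) σ (cfInr cV) (inrT tV) (s≤s sz) with hsubV r h n σ cV tV sz
  ... | W , s , u , d = _ , σinr ◅ gmap inr ξinr s , inrT u , cfInr d
  hsubV r h (suc n) σ (cfThunk cE) (thunkT tE) (s≤s sz) with hsubK r h n σ cE tE sz
  ... | e , s , u , d = _ , σthunk ◅ gmap thunk ξthunk s , thunkT u , cfThunk d

  hsubK : ∀ r {Cuttable} (h : CutHandler r Cuttable) n {Γ Δ Vs es Ps Qs e P} →
          CutFreeSub r Cuttable Γ Δ Vs es Ps Qs → CutFreeK e → CtxTy (Ps ++ Γ) (Qs ++ Δ) e P →
          szK e ≤ n → ResK Γ Δ (ksub e (Vs ,, es)) P
  hsubK r h n σ (cfCovar {j}) (covarT jeq) sz
    with lookupK j (ctxsTy σ) (ctxsCF σ) (ctxsRank σ) jeq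
  ... | inj₁ (e , eeq , tE , cE , _) = e , σcovar∈ eeq ◅ ε , tE , cE
  ... | inj₂ (le , eq)               = _ , σcovar∉ le ◅ ε , covarT eq , cfCovar
  hsubK r h (suc n) σ (cfMut cc) (mutT tc) (s≤s sz) with hsubUnderV r h n (_ ∷ []) σ cc tc sz
  ... | c' , s , t , cf = _ , σmut ◅ gmap mut ξmut s , mutT t , cfMut cf
  hsubK r h n σ (cfMutneg cc)      tE sz = matchingReduct (hsubMatching r h n σ (mNeg cc) tE sz)
  hsubK r h n σ (cfMupair cc)      tE sz = matchingReduct (hsubMatching r h n σ (mPair cc) tE sz)
  hsubK r h n σ (cfMucase c₁ c₂) tE sz = matchingReduct (hsubMatching r h n σ (mCase c₁ c₂) tE sz)

  hsubUnderV : ∀ r {Cuttable} (h : CutHandler r Cuttable) n (As : List Formula)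
               {Γ Δ Vs es Ps Qs c} → CutFreeSub r Cuttable Γ Δ Vs es Ps Qs → CutFreeC c →
               CmdTy (As ++ Ps ++ Γ) (Qs ++ Δ) c → szC c ≤ n →
               ResC (As ++ Γ) Δ (csub (renC (rot (length As) (length Vs)) idℕ c)
                                      (wkVar (length As) (Vs ,, es)))
  hsubUnderV r h n As {Ps = Ps} σ cc tc sz =
    hsubC r h n (renSub (wkTy As) idTy σ) (renCFC cc)
      (renTyC cc (rotTy As Ps (sym (lenVs (valsTy σ)))) idTy tc) (szRen≤ cc sz)

  hsubUnderK : ∀ r {Cuttable} (h : CutHandler r Cuttable) n (As : List Formula)
               {Γ Δ Vs es Ps Qs c} → CutFreeSub r Cuttable Γ Δ Vs es Ps Qs → CutFreeC c →
               CmdTy (Ps ++ Γ) (As ++ Qs ++ Δ) c → szC c ≤ n →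
               ResC Γ (As ++ Δ) (csub (renC idℕ (rot (length As) (length es)) c)
                                      (wkCovar (length As) (Vs ,, es)))
  hsubUnderK r h n As {Qs = Qs} σ cc tc sz =
    hsubC r h n (renSub idTy (wkTy As) σ) (renCFC cc)
      (renTyC cc idTy (rotTy As Qs (sym (lenKs (ctxsTy σ)))) tc) (szRen≤ cc sz)

substE : ∀ r {Γ Δ Vs es Ps Qs v P} → CutFreeSub r (λ _ → ⊤) Γ Δ Vs es Ps Qs →
         CutFreeE v → ExpTy (Ps ++ Γ) (Qs ++ Δ) v P → ResE Γ Δ (esub v (Vs ,, es)) P
substE r σ (cfVal {V} cV) (valT tV) with hsubV r (cutVal r) (szV V) σ cV tV ≤-refl
... | W , s , t , c = val W , σval ◅ gmap val ξval s , valT t , cfVal c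
substE r σ (cfMu {c} cc) (muT tc) with hsubUnderK r (cutVal r) (szC c) (_ ∷ []) σ cc tc ≤-refl
... | c' , s , t , cf = mu c' , σmu ◅ gmap mu ξmu s , muT t , cfMu cf

cutExpr : ∀ r {Γ Δ v e P} → Rank≤ r P → CutFreeE v → ExpTy Γ Δ v P → CutFreeK e →
          CtxTy Γ Δ e P → ResC Γ Δ ⟨ v ∣ e ⟩
cutExpr r b (cfVal cV) (valT tV) cE tE = cutVal r tt b cV cE tV tE
cutExpr r b (cfMu cc)  (muT tc)  cE tE = (βμ ◅ ε) ▷ substC r (ctxSub tE cE b) cc tc

mutual
  normC : ∀ {Γ Δ c} → CmdTy Γ Δ c → ResC Γ Δ c
  normC (cutT {v} {e} {P} tv te) with normE tv | normK te
  ... | v' , sv , tv' , cv | e' , se , te' , ce =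
    (gmap (λ x → ⟨ x ∣ e ⟩) ξcutˡ sv ◅◅ gmap (λ x → ⟨ v' ∣ x ⟩) ξcutʳ se)
      ▷ cutExpr (conns P) (rank≤conns P ≤-refl) cv tv' ce te'
  normC (csubT vt kt tc) with normC tc | normSub vt kt
  ... | c' , sc , tc' , cc | _ , _ , sσ , σ =
    (gmap (λ x → csub x _) ξsubˡ sc ◅◅ gmap (csub c') ξsubʳ sσ) ▷ substC _ σ cc tc'

  normE : ∀ {Γ Δ v P} → ExpTy Γ Δ v P → ResE Γ Δ v P
  normE (valT tV) with normV tV
  ... | V' , s , t , c = val V' , gmap val ξval s , valT t , cfVal c
  normE (muT tc) with normC tc
  ... | c' , s , t , c = mu c' , gmap mu ξmu s , muT t , cfMu c
  normE (esubT vt kt tv) with normE tv | normSub vt kt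
  ... | v' , sv , tv' , cv | _ , _ , sσ , σ =
    (gmap (λ x → esub x _) ξsubˡ sv ◅◅ gmap (esub v') ξsubʳ sσ) ▷ substE _ σ cv tv'

  normV : ∀ {Γ Δ V P} → ValTy Γ Δ V P → ResV Γ Δ V P
  normV (varT eq) = _ , ε , varT eq , cfVar
  normV (pairT t₁ t₂) with normV t₁ | normV t₂
  ... | W₁ , s₁ , u₁ , d₁ | W₂ , s₂ , u₂ , d₂ =
    _ , (gmap (λ x → pair x _) ξpairˡ s₁ ◅◅ gmap (pair W₁) ξpairʳ s₂) , pairT u₁ u₂ , cfPairV d₁ d₂
  normV (inlT t) with normV t
  ... | W , s , u , d = _ , gmap inl ξinl s , inlT u , cfInl d
  normV (inrT t) with normV t
  ... | W , s , u , d = _ , gmap inr ξinr s , inrT u , cfInr d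
  normV (thunkT t) with normK t
  ... | e , s , u , d = _ , gmap thunk ξthunk s , thunkT u , cfThunk d
  normV (vsubT vt kt tV) with normV tV | normSub vt kt
  ... | V' , sV , tV' , cV | _ , _ , sσ , σ =
    (gmap (λ x → vsub x _) ξsubˡ sV ◅◅ gmap (vsub V') ξsubʳ sσ)
      ▷ hsubV _ (cutVal _) (szV V') σ cV tV' ≤-refl

  normK : ∀ {Γ Δ e P} → CtxTy Γ Δ e P → ResK Γ Δ e P
  normK (covarT eq) = _ , ε , covarT eq , cfCovar
  normK (mutT t) with normC t
  ... | c , s , u , d = _ , gmap mut ξmut s , mutT u , cfMut d
  normK (mutnegT t) with normC t
  ... | c , s , u , d = _ , gmap mutneg ξmutneg s , mutnegT u , cfMutneg d
  normK (mupairT t) with normC t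
  ... | c , s , u , d = _ , gmap mupair ξmupair s , mupairT u , cfMupair d
  normK (mucaseT t₁ t₂) with normC t₁ | normC t₂
  ... | c₁ , s₁ , u₁ , d₁ | c₂ , s₂ , u₂ , d₂ =
    _ , (gmap (λ x → mucase x _) ξmucaseˡ s₁ ◅◅ gmap (mucase c₁) ξmucaseʳ s₂) ,
    mucaseT u₁ u₂ , cfMucase d₁ d₂
  normK (ksubT vt kt tE) with normK tE | normSub vt kt
  ... | e' , sE , tE' , cE | _ , _ , sσ , σ =
    (gmap (λ x → ksub x _) ξsubˡ sE ◅◅ gmap (ksub e') ξsubʳ sσ)
      ▷ hsubK _ (cutVal _) (szK e') σ cE tE' ≤-refl

  normVs : ∀ {Γ Δ Vs Ps} → ValsTy Γ Δ Vs Ps →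
           Reduct _⟶vs_ (λ Vs' → ValsTy Γ Δ Vs' Ps) (All CutFreeV) Vs
  normVs [] = [] , ε , [] , []
  normVs (t ∷ ts) with normV t | normVs ts
  ... | W , s , u , d | Ws , ss , us , ds =
    W ∷ Ws , (gmap (λ x → x ∷ _) here s ◅◅ gmap (W ∷_) there ss) , u ∷ us , d ∷ ds

  normKs : ∀ {Γ Δ es Qs} → CtxsTy Γ Δ es Qs →
           Reduct _⟶ks_ (λ es' → CtxsTy Γ Δ es' Qs) (All CutFreeK) es
  normKs [] = [] , ε , [] , []
  normKs (t ∷ ts) with normK t | normKs ts
  ... | e , s , u , d | es , ss , us , ds =
    e ∷ es , (gmap (λ x → x ∷ _) here s ◅◅ gmap (e ∷_) there ss) , u ∷ us , d ∷ ds

  normSub : ∀ {Γ Δ Vs es Ps Qs} → ValsTy Γ Δ Vs Ps → CtxsTy Γ Δ es Qs →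
            Σ (List Val) λ Vs' → Σ (List Ctx) λ es' → Star _⟶s_ (Vs ,, es) (Vs' ,, es') ×
              CutFreeSub (rankOf Ps Qs) (λ _ → ⊤) Γ Δ Vs' es' Ps Qs
  normSub {Ps = Ps} {Qs} vt kt with normVs vt | normKs kt
  ... | Vs' , sV , vt' , vc | es' , sK , kt' , kc =
    Vs' , es' , gmap (λ x → x ,, _) ξVs sV ◅◅ gmap (λ x → Vs' ,, x) ξes sK ,
    sub vt' kt' vc kc (allRank≤ Ps (m≤m+n (connsL Ps) (connsL Qs)))
                      (All.map (λ b → b , tt) (allRank≤ Qs (m≤n+m (connsL Qs) (connsL Ps))))

mutual
  nfC : ∀ {c} → CutFreeC c → NormalC c
  nfC (cfAx cV)      (ξcutˡ (ξval s))       = nfV cV s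
  nfC (cfAx cV)      (ξcutʳ ())
  nfC (cfNeg cc)     (ξcutˡ (ξval ()))
  nfC (cfNeg cc)     (ξcutʳ (ξmutneg s))    = nfC cc s
  nfC (cfPair cc)    (ξcutˡ (ξval ()))
  nfC (cfPair cc)    (ξcutʳ (ξmupair s))    = nfC cc s
  nfC (cfCase c₁ c₂) (ξcutˡ (ξval ()))
  nfC (cfCase c₁ c₂) (ξcutʳ (ξmucaseˡ s))   = nfC c₁ s
  nfC (cfCase c₁ c₂) (ξcutʳ (ξmucaseʳ s))   = nfC c₂ s

  nfE : ∀ {v} → CutFreeE v → NormalE v
  nfE (cfVal cV) (ξval s) = nfV cV s
  nfE (cfMu cc)  (ξmu s)  = nfC cc s

  nfV : ∀ {V} → CutFreeV V → NormalV V
  nfV cfVar ()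
  nfV (cfPairV a b) (ξpairˡ s) = nfV a s
  nfV (cfPairV a b) (ξpairʳ s) = nfV b s
  nfV (cfInl a)     (ξinl s)   = nfV a s
  nfV (cfInr a)     (ξinr s)   = nfV a s
  nfV (cfThunk k)   (ξthunk s) = nfK k s

  nfK : ∀ {e} → CutFreeK e → NormalK e
  nfK cfCovar ()
  nfK (cfMut c)        (ξmut s)     = nfC c s
  nfK (cfMutneg c)     (ξmutneg s)  = nfC c s
  nfK (cfMupair c)     (ξmupair s)  = nfC c s
  nfK (cfMucase c₁ c₂) (ξmucaseˡ s) = nfC c₁ s
  nfK (cfMucase c₁ c₂) (ξmucaseʳ s) = nfC c₂ s

withNormal : ∀ {A : Set} {R : A → A → Set} {Ty CF Normal : A → Set} {t} →
             (∀ {t'} → CF t' → Normal t') → Reduct R Ty CF t →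
             Σ A λ t' → Star R t t' × Ty t' × Normal t' × CF t'
withNormal nf (t' , s , ty , cf) = t' , s , ty , nf cf , cf

proposition2 :
    (∀ (Γ Δ : List Formula) (c : Cmd) → CmdTy Γ Δ c →
      Σ Cmd (λ c' → Star _⟶c_ c c' × CmdTy Γ Δ c' × NormalC c' × CutFreeC c'))
    ×
    (∀ (Γ Δ : List Formula) (v : Expr) (P : Formula) → ExpTy Γ Δ v P →
      Σ Expr (λ v' → Star _⟶e_ v v' × ExpTy Γ Δ v' P × NormalE v' × CutFreeE v'))
    ×
    (∀ (Γ Δ : List Formula) (V : Val) (P : Formula) → ValTy Γ Δ V P →
      Σ Val (λ V' → Star _⟶v_ V V' × ValTy Γ Δ V' P × NormalV V' × CutFreeV V'))
    ×
    (∀ (Γ Δ : List Formula) (e : Ctx) (P : Formula) → CtxTy Γ Δ e P →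
      Σ Ctx (λ e' → Star _⟶k_ e e' × CtxTy Γ Δ e' P × NormalK e' × CutFreeK e'))
proposition2 =
  (λ Γ Δ c   t → withNormal nfC (normC t)) ,
  (λ Γ Δ v P t → withNormal nfE (normE t)) ,
  (λ Γ Δ V P t → withNormal nfV (normV t)) ,
  (λ Γ Δ e P t → withNormal nfK (normK t))
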